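{- Let $y=\tan x$, $z=\sec x$, $D=d/dx$, and define $(Dy)^0(f)=f$, $(Dy)^{n+1}(f)=D\big(y\,(Dy)^n(f)\big)$. For $n\ge1$ write $$(Dy)^n(y)=\sum_{k=1}^{n}E(n,k)\,y^{2n-2k+1}z^{2k}.$$ Then for $1\le k\le n$, $E(n,k)=2^nA(n,k)$, where $A(n,k)$ is the Eulerian number.
   Context: The Eulerian number $A(n,k)$ is the number of permutations $\pi$ of $\{1,\dots,n\}$ with exactly $k-1$ descents, a descent being a position $i\in\{1,\dots,n-1\}$ with $\pi(i)>\pi(i+1)$; i.e. $\sum_{\pi\in S_n}x^{\mathrm{des}(\pi)+1}=\sum_{k=1}^nA(n,k)x^k$. -}

module Defs where

open import Data.Nat using (ℕ; zero; suc; _+_; _*_; _∸_; _≡ᵇ_; _<ᵇ_)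
open import Data.Bool using (Bool; true; false; _∧_; not; if_then_else_)
open import Data.Product using (_×_; _,_)
open import Data.List using (List; []; _∷_; map; concatMap; length; filter; allFin)
open import Data.Nat.ListAction using (sum)
open import Data.Fin using (Fin; toℕ)
open import Data.Vec using (Vec; []; _∷_)
open import Relation.Nullary.Decidable using (does)
open import Relation.Binary.PropositionalEquality using (_≡_; refl)
open import Data.Bool.Properties using () renaming (_≟_ to _≟B_)

-- Formal polynomials in y = tan x, z = sec x, with ℕ coefficients.
-- A polynomial is a formal sum of monomials; (c , i , j) stands for c·yⁱzʲ.

Mon : Set
Mon = ℕ × ℕ × ℕ

Poly : Set
Poly = List Mon

-- D = d/dx acting via D y = z², D z = y z (since (tan)' = sec², (sec)' = tan·sec):
-- D (c yⁱ zʲ) = c·i·y^(i-1) z^(j+2) + c·j·y^(i+1) z^j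
Dmon : Mon → Poly
Dmon (c , i , j) = (c * i , i ∸ 1 , j + 2) ∷ (c * j , suc i , j) ∷ []

D : Poly → Poly
D = concatMap Dmon

mulY : Poly → Poly
mulY = map (λ { (c , i , j) → (c , suc i , j) })

DyPow : ℕ → Poly → Poly
DyPow zero    f = f
DyPow (suc n) f = D (mulY (DyPow n f))

coeff : Poly → ℕ → ℕ → ℕ
coeff p i j = sum (map (λ { (c , i' , j') → if (i ≡ᵇ i') ∧ (j ≡ᵇ j') then c else 0 }) p)

polyY : Poly
polyY = (1 , 1 , 0) ∷ []

E : ℕ → ℕ → ℕ
E n k = coeff (DyPow n polyY) (2 * n ∸ 2 * k + 1) (2 * k)

-- Eulerian numbers via permutations.
-- A permutation π of {1..n} is represented by its one-line notation
-- (π(1), …, π(n)) as an injective vector in Vec (Fin n) n.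

allVecs : (n m : ℕ) → List (Vec (Fin m) n)
allVecs zero    m = [] ∷ []
allVecs (suc n) m = concatMap (λ v → map (λ a → a ∷ v) (allFin m)) (allVecs n m)

notIn : ∀ {m n} → Fin m → Vec (Fin m) n → Bool
notIn a []       = true
notIn a (b ∷ v)  = not (toℕ a ≡ᵇ toℕ b) ∧ notIn a v

distinct : ∀ {m n} → Vec (Fin m) n → Bool
distinct []      = true
distinct (a ∷ v) = notIn a v ∧ distinct v

des : ∀ {m n} → Vec (Fin m) n → ℕ
des []            = 0
des (a ∷ [])      = 0
des (a ∷ b ∷ v)   = (if toℕ b <ᵇ toℕ a then 1 else 0) + des (b ∷ v)

Eulerian : ℕ → ℕ → ℕ
Eulerian n k =
  length (filter (λ v → (distinct v ∧ (suc (des v) ≡ᵇ k)) ≟B true) (allVecs n n))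

module Submission where

-- Both sides are matched against one Eulerian triangle eulerianTri d a
-- (permutations with d descents and a ascents), defined by the recurrence
-- A(n,k) = k A(n-1,k) + (n-k+1) A(n-1,k-1).
--
-- Permutation side (eulerian-eulerianTri): splitting words over Fin m by their
-- first letter and relabelling the rest along punchIn (count-cons,
-- count-avoiding) turns the enumerative definition of A into a numeric
-- recursion headDes for permutations refined by their first letter.  Inserting
-- the maximum (insertMax, expressed by the sequence operator ins) then gives
-- the Eulerian recurrence for the totals (totalDes-rec).
--
-- Polynomial side (coeff-iterDy): f ↦ D(y f) acts on coefficients by
-- [yⁱzʲ] ↦ (i+1)[yⁱz^(j-2)] + j[y^(i-2)zʲ] (coeff-D-mulY), which on the
-- exponents occurring in (Dy)ⁿy is twice the triangle recurrence.

open import Defs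
open import Data.Nat using (ℕ; _≤_; _*_; _^_)
open import Relation.Binary.PropositionalEquality using (_≡_)

open import Data.Nat using (zero; suc; _+_; _∸_; _≡ᵇ_; _<ᵇ_; _<_)
open import Data.Nat.Properties
open import Data.Nat.ListAction using (sum)
open import Data.Nat.ListAction.Properties using (sum-++)
open import Data.Bool using (Bool; true; false; _∧_; not; if_then_else_; T)
open import Relation.Nullary using (yes; no)
open import Data.Empty using (⊥-elim)
open import Data.Bool.Properties using (∧-assoc; ∧-zeroʳ) renaming (_≟_ to _≟B_)
open import Data.Product using (_,_)
open import Data.List using (List; []; _∷_; _++_; map; concatMap; length; filter; tabulate)
open import Data.List.Properties using (map-++; map-tabulate)
open import Data.Fin using (Fin; toℕ; punchIn) renaming (zero to fzero; suc to fsuc)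
open import Data.Fin.Properties using (toℕ<n; toℕ-inject₁; toℕ-fromℕ)
open import Data.Vec using (Vec) renaming ([] to []ᵥ; _∷_ to _∷ᵥ_; map to mapᵥ)
open import Algebra.Properties.Semiring.Sum +-*-semiring
  using (sum-syntax; sum-cong-≗; ∑-distrib-+; *-distribˡ-sum; sum-init-last; sum-replicate-zero)
open import Relation.Binary.PropositionalEquality using (refl; sym; trans; cong; cong₂; subst; module ≡-Reasoning)
open import Data.Nat.Tactic.RingSolver using (solve-∀)
open ≡-Reasoning

𝟙 : Bool → ℕ
𝟙 true  = 1
𝟙 false = 0

𝟙-∧ : ∀ x y → 𝟙 (x ∧ y) ≡ 𝟙 x * 𝟙 y
𝟙-∧ false y = refl
𝟙-∧ true  y = sym (+-identityʳ (𝟙 y))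

listSum : ∀ {A : Set} → (A → ℕ) → List A → ℕ
listSum f xs = sum (map f xs)

listSum-cong : ∀ {A : Set} {f g : A → ℕ} (xs : List A) → (∀ x → f x ≡ g x) → listSum f xs ≡ listSum g xs
listSum-cong []       e = refl
listSum-cong (x ∷ xs) e = cong₂ _+_ (e x) (listSum-cong xs e)

listSum-zero : ∀ {A : Set} (xs : List A) → listSum (λ _ → 0) xs ≡ 0
listSum-zero []       = refl
listSum-zero (x ∷ xs) = listSum-zero xs

listSum-* : ∀ {A : Set} c (f : A → ℕ) (xs : List A) → listSum (λ x → c * f x) xs ≡ c * listSum f xs
listSum-* c f []       = sym (*-zeroʳ c)
listSum-* c f (x ∷ xs) = trans (cong (c * f x +_) (listSum-* c f xs)) (sym (*-distribˡ-+ c (f x) _))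

listSum-concatMap : ∀ {A B : Set} (f : B → ℕ) (g : A → List B) (xs : List A) →
  listSum f (concatMap g xs) ≡ listSum (λ x → listSum f (g x)) xs
listSum-concatMap f g []       = refl
listSum-concatMap f g (x ∷ xs) = begin
  sum (map f (g x ++ concatMap g xs))   ≡⟨ cong sum (map-++ f (g x) _) ⟩
  sum (map f (g x) ++ map f (concatMap g xs)) ≡⟨ sum-++ (map f (g x)) _ ⟩
  listSum f (g x) + listSum f (concatMap g xs)    ≡⟨ cong (listSum f (g x) +_) (listSum-concatMap f g xs) ⟩
  listSum (λ x → listSum f (g x)) (x ∷ xs) ∎

listSum-tabulate : ∀ {A : Set} m (f : A → ℕ) (g : Fin m → A) → listSum f (tabulate g) ≡ ∑[ i < m ] f (g i)
listSum-tabulate zero    f g = refl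
listSum-tabulate (suc m) f g = cong (f (g fzero) +_) (listSum-tabulate m f (λ i → g (fsuc i)))

listSum-∑ : ∀ {A : Set} m (G : Fin m → A → ℕ) (xs : List A) →
  listSum (λ x → ∑[ a < m ] G a x) xs ≡ ∑[ a < m ] listSum (G a) xs
listSum-∑ m G []       = sym (sum-replicate-zero m)
listSum-∑ m G (x ∷ xs) = trans (cong (∑[ a < m ] G a x +_) (listSum-∑ m G xs))
                               (sym (∑-distrib-+ (λ a → G a x) (λ a → listSum (G a) xs)))

count : (n m : ℕ) → (Vec (Fin m) n → ℕ) → ℕ
count n m f = listSum f (allVecs n m)

count-* : ∀ n m c (f : Vec (Fin m) n → ℕ) → count n m (λ v → c * f v) ≡ c * count n m f
count-* n m c f = listSum-* c f (allVecs n m)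

count-cons : ∀ n m (f : Vec (Fin m) (suc n) → ℕ) → count (suc n) m f ≡ ∑[ a < m ] count n m (λ v → f (a ∷ᵥ v))
count-cons n m f = begin
  listSum f (concatMap (λ v → map (_∷ᵥ v) (tabulate (λ a → a))) (allVecs n m))
    ≡⟨ listSum-concatMap f _ (allVecs n m) ⟩
  listSum (λ v → listSum f (map (_∷ᵥ v) (tabulate (λ a → a)))) (allVecs n m)
    ≡⟨ listSum-cong (allVecs n m) (λ v → cong (listSum f) (map-tabulate (λ a → a) (_∷ᵥ v))) ⟩
  listSum (λ v → listSum f (tabulate (_∷ᵥ v))) (allVecs n m)
    ≡⟨ listSum-cong (allVecs n m) (λ v → listSum-tabulate m f (_∷ᵥ v)) ⟩
  listSum (λ v → ∑[ a < m ] f (a ∷ᵥ v)) (allVecs n m)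
    ≡⟨ listSum-∑ m (λ a v → f (a ∷ᵥ v)) (allVecs n m) ⟩
  ∑[ a < m ] count n m (λ v → f (a ∷ᵥ v)) ∎

length-filter : ∀ {A : Set} (b : A → Bool) (xs : List A) →
  length (filter (λ x → b x ≟B true) xs) ≡ listSum (λ x → 𝟙 (b x)) xs
length-filter b []       = refl
length-filter b (x ∷ xs) with b x
... | true  = cong suc (length-filter b xs)
... | false = length-filter b xs

-- punchIn a : Fin m → Fin (suc m) is the order embedding skipping a, so it
-- preserves the comparisons that define distinctness and descents.
punchIn-≡ᵇ : ∀ {m} (a : Fin (suc m)) (x y : Fin m) →
  (toℕ (punchIn a x) ≡ᵇ toℕ (punchIn a y)) ≡ (toℕ x ≡ᵇ toℕ y)
punchIn-≡ᵇ fzero    x        y        = refl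
punchIn-≡ᵇ (fsuc a) fzero    fzero    = refl
punchIn-≡ᵇ (fsuc a) fzero    (fsuc y) = refl
punchIn-≡ᵇ (fsuc a) (fsuc x) fzero    = refl
punchIn-≡ᵇ (fsuc a) (fsuc x) (fsuc y) = punchIn-≡ᵇ a x y

punchIn-<ᵇ : ∀ {m} (a : Fin (suc m)) (x y : Fin m) →
  (toℕ (punchIn a x) <ᵇ toℕ (punchIn a y)) ≡ (toℕ x <ᵇ toℕ y)
punchIn-<ᵇ fzero    x        y        = refl
punchIn-<ᵇ (fsuc a) fzero    fzero    = refl
punchIn-<ᵇ (fsuc a) fzero    (fsuc y) = refl
punchIn-<ᵇ (fsuc a) (fsuc x) fzero    = refl
punchIn-<ᵇ (fsuc a) (fsuc x) (fsuc y) = punchIn-<ᵇ a x y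

punchIn-<ᵇ-skipped : ∀ {m} (a : Fin (suc m)) (x : Fin m) → (toℕ (punchIn a x) <ᵇ toℕ a) ≡ (toℕ x <ᵇ toℕ a)
punchIn-<ᵇ-skipped fzero    x        = refl
punchIn-<ᵇ-skipped (fsuc a) fzero    = refl
punchIn-<ᵇ-skipped (fsuc a) (fsuc x) = punchIn-<ᵇ-skipped a x

notIn-punchIn : ∀ {m n} (a : Fin (suc m)) (x : Fin m) (w : Vec (Fin m) n) →
  notIn (punchIn a x) (mapᵥ (punchIn a) w) ≡ notIn x w
notIn-punchIn a x []ᵥ      = refl
notIn-punchIn a x (y ∷ᵥ w) rewrite punchIn-≡ᵇ a x y | notIn-punchIn a x w = refl

distinct-punchIn : ∀ {m n} (a : Fin (suc m)) (w : Vec (Fin m) n) → distinct (mapᵥ (punchIn a) w) ≡ distinct w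
distinct-punchIn a []ᵥ      = refl
distinct-punchIn a (x ∷ᵥ w) rewrite notIn-punchIn a x w | distinct-punchIn a w = refl

des-punchIn : ∀ {m n} (a : Fin (suc m)) (w : Vec (Fin m) n) → des (mapᵥ (punchIn a) w) ≡ des w
des-punchIn a []ᵥ           = refl
des-punchIn a (x ∷ᵥ []ᵥ)     = refl
des-punchIn a (x ∷ᵥ y ∷ᵥ w) =
  cong₂ _+_ (cong (λ b → if b then 1 else 0) (punchIn-<ᵇ a y x)) (des-punchIn a (y ∷ᵥ w))

∑-skip : ∀ m (a : Fin (suc m)) (G : Fin (suc m) → ℕ) →
  ∑[ b < suc m ] (𝟙 (not (toℕ a ≡ᵇ toℕ b)) * G b) ≡ ∑[ c < m ] G (punchIn a c)
∑-skip m       fzero    G = sum-cong-≗ (λ c → +-identityʳ (G (fsuc c)))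
∑-skip (suc m) (fsuc a) G = cong₂ _+_ (+-identityʳ (G fzero)) (∑-skip m a (λ b → G (fsuc b)))

count-avoiding : ∀ n m (a : Fin (suc m)) (Q : Vec (Fin (suc m)) n → ℕ) →
  count n (suc m) (λ v → 𝟙 (notIn a v) * Q v) ≡ count n m (λ w → Q (mapᵥ (punchIn a) w))
count-avoiding zero    m a Q = cong (_+ 0) (+-identityʳ (Q []ᵥ))
count-avoiding (suc n) m a Q = begin
  count (suc n) (suc m) (λ v → 𝟙 (notIn a v) * Q v)
    ≡⟨ count-cons n (suc m) _ ⟩
  ∑[ b < suc m ] count n (suc m) (λ v → 𝟙 (a≢ b ∧ notIn a v) * Q (b ∷ᵥ v))
    ≡⟨ sum-cong-≗ (λ b → trans (count-cong b) (count-* n (suc m) (𝟙 (a≢ b)) _)) ⟩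
  ∑[ b < suc m ] (𝟙 (a≢ b) * count n (suc m) (λ v → 𝟙 (notIn a v) * Q (b ∷ᵥ v)))
    ≡⟨ sum-cong-≗ (λ b → cong (𝟙 (a≢ b) *_) (count-avoiding n m a (λ v → Q (b ∷ᵥ v)))) ⟩
  ∑[ b < suc m ] (𝟙 (a≢ b) * count n m (λ w → Q (b ∷ᵥ mapᵥ (punchIn a) w)))
    ≡⟨ ∑-skip m a (λ b → count n m (λ w → Q (b ∷ᵥ mapᵥ (punchIn a) w))) ⟩
  ∑[ c < m ] count n m (λ w → Q (punchIn a c ∷ᵥ mapᵥ (punchIn a) w))
    ≡⟨ count-cons n m _ ⟨
  count (suc n) m (λ w → Q (mapᵥ (punchIn a) w)) ∎
  where
  a≢_ : Fin (suc m) → Bool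
  a≢ b = not (toℕ a ≡ᵇ toℕ b)
  count-cong : ∀ b → count n (suc m) (λ v → 𝟙 (a≢ b ∧ notIn a v) * Q (b ∷ᵥ v))
                   ≡ count n (suc m) (λ v → 𝟙 (a≢ b) * (𝟙 (notIn a v) * Q (b ∷ᵥ v)))
  count-cong b = listSum-cong (allVecs n (suc m)) λ v →
    trans (cong (_* Q (b ∷ᵥ v)) (𝟙-∧ (a≢ b) (notIn a v))) (*-assoc (𝟙 (a≢ b)) _ _)

-- Descent-count sequences f : ℕ → ℕ (f d = number of objects with d descents).
-- shift f counts the same objects after each one acquires an extra descent.
shift : (ℕ → ℕ) → ℕ → ℕ
shift f zero    = 0
shift f (suc d) = f d

-- step b f shifts exactly when b holds (b = "the first position is a descent").
step : Bool → (ℕ → ℕ) → ℕ → ℕ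
step true  f = shift f
step false f = f

shift-cong : ∀ {f g : ℕ → ℕ} → (∀ d → f d ≡ g d) → ∀ d → shift f d ≡ shift g d
shift-cong e zero    = refl
shift-cong e (suc d) = e d

step-cong : ∀ b {f g : ℕ → ℕ} → (∀ d → f d ≡ g d) → ∀ d → step b f d ≡ step b g d
step-cong true  e = shift-cong e
step-cong false e = e

headCount : (n m : ℕ) → Fin m → ℕ → ℕ
headCount n m a d = count n m (λ v → 𝟙 (distinct (a ∷ᵥ v) ∧ (des (a ∷ᵥ v) ≡ᵇ d)))

count-step : ∀ n m (c : Fin m) b d →
  count n m (λ w → 𝟙 (distinct (c ∷ᵥ w) ∧ ((if b then 1 else 0) + des (c ∷ᵥ w) ≡ᵇ d)))
    ≡ step b (headCount n m c) d
count-step n m c false d       = refl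
count-step n m c true  (suc d) = refl
count-step n m c true  zero    =
  trans (listSum-cong (allVecs n m) (λ w → cong 𝟙 (∧-zeroʳ (distinct (c ∷ᵥ w))))) (listSum-zero (allVecs n m))

-- Removing the first letter a of an injective word and relabelling the rest
-- along punchIn a: the second letter c starts the new word, and the removed
-- position was a descent exactly when c < a.
headCount-step : ∀ n m (a : Fin (suc m)) d →
  headCount (suc n) (suc m) a d ≡ ∑[ c < m ] step (toℕ c <ᵇ toℕ a) (headCount n m c) d
headCount-step n m a d = begin
  headCount (suc n) (suc m) a d                   ≡⟨ listSum-cong (allVecs (suc n) (suc m)) split ⟩
  count (suc n) (suc m) (λ u → 𝟙 (notIn a u) * R u) ≡⟨ count-avoiding (suc n) m a R ⟩
  count (suc n) m (λ w → R (mapᵥ (punchIn a) w))  ≡⟨ listSum-cong (allVecs (suc n) m) relabel ⟩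
  count (suc n) m R                               ≡⟨ count-cons n m R ⟩
  ∑[ c < m ] count n m (λ w → R (c ∷ᵥ w))         ≡⟨ sum-cong-≗ (λ c → count-step n m c (toℕ c <ᵇ toℕ a) d) ⟩
  ∑[ c < m ] step (toℕ c <ᵇ toℕ a) (headCount n m c) d ∎
  where
  -- the condition on a ∷ u other than a ∉ u, read off from u (over either alphabet)
  R : ∀ {k} → Vec (Fin k) (suc n) → ℕ
  R (b ∷ᵥ v) = 𝟙 (distinct (b ∷ᵥ v) ∧ ((if toℕ b <ᵇ toℕ a then 1 else 0) + des (b ∷ᵥ v) ≡ᵇ d))
  split : ∀ u → 𝟙 (distinct (a ∷ᵥ u) ∧ (des (a ∷ᵥ u) ≡ᵇ d)) ≡ 𝟙 (notIn a u) * R u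
  split (b ∷ᵥ v) = trans (cong 𝟙 (∧-assoc (notIn a (b ∷ᵥ v)) (distinct (b ∷ᵥ v)) _)) (𝟙-∧ (notIn a (b ∷ᵥ v)) _)
  relabel : ∀ w → R (mapᵥ (punchIn a) w) ≡ R w
  relabel (c ∷ᵥ w) rewrite distinct-punchIn a (c ∷ᵥ w) | des-punchIn a (c ∷ᵥ w) | punchIn-<ᵇ-skipped a c = refl

-- headDes n a d: permutations of {0, …, n} starting with a and having d
-- descents, computed by the recursion that headCount-step establishes.
headDes : ℕ → ℕ → ℕ → ℕ
headDes zero    a d = 𝟙 (0 ≡ᵇ d)
headDes (suc n) a d = ∑[ c < suc n ] step (toℕ c <ᵇ a) (headDes n (toℕ c)) d

-- totalDes n d: permutations of {0, …, n} with d descents.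
totalDes : ℕ → ℕ → ℕ
totalDes n d = ∑[ a < suc n ] headDes n (toℕ a) d

headCount-headDes : ∀ n (a : Fin (suc n)) d → headCount n (suc n) a d ≡ headDes n (toℕ a) d
headCount-headDes zero    fzero d = +-identityʳ _
headCount-headDes (suc n) a     d = trans (headCount-step n (suc n) a d)
  (sum-cong-≗ (λ c → step-cong (toℕ c <ᵇ toℕ a) (headCount-headDes n c) d))

eulerian-totalDes : ∀ n d → Eulerian (suc n) (suc d) ≡ totalDes n d
eulerian-totalDes n d = begin
  Eulerian (suc n) (suc d)
    ≡⟨ length-filter (λ v → distinct v ∧ (suc (des v) ≡ᵇ suc d)) (allVecs (suc n) (suc n)) ⟩
  count (suc n) (suc n) (λ v → 𝟙 (distinct v ∧ (des v ≡ᵇ d)))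
    ≡⟨ count-cons n (suc n) _ ⟩
  ∑[ a < suc n ] headCount n (suc n) a d
    ≡⟨ sum-cong-≗ (λ a → headCount-headDes n a d) ⟩
  totalDes n d ∎

∑-last : ∀ m (g : ℕ → ℕ) → ∑[ c < suc m ] g (toℕ c) ≡ ∑[ c < m ] g (toℕ c) + g m
∑-last m g = trans (sum-init-last {m} (λ c → g (toℕ c)))
  (cong₂ _+_ (sum-cong-≗ {m} (λ c → cong g (toℕ-inject₁ c))) (cong g (toℕ-fromℕ m)))

∑-cong< : ∀ m (f g : ℕ → ℕ) → (∀ c → c < m → f c ≡ g c) → ∑[ c < m ] f (toℕ c) ≡ ∑[ c < m ] g (toℕ c)
∑-cong< m f g e = sum-cong-≗ (λ c → e (toℕ c) (toℕ<n c))

shift-∑ : ∀ m (g : Fin m → ℕ → ℕ) d → shift (λ e → ∑[ c < m ] g c e) d ≡ ∑[ c < m ] shift (g c) d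
shift-∑ m g zero    = sym (sum-replicate-zero m)
shift-∑ m g (suc d) = refl

VanishesAbove : ℕ → (ℕ → ℕ) → Set
VanishesAbove n f = ∀ d → n < d → f d ≡ 0

step-vanishes : ∀ {n f} b → VanishesAbove n f → VanishesAbove (suc n) (step b f)
step-vanishes true  v (suc d) n<d = v d (≤-pred n<d)
step-vanishes false v d       n<d = v d (<⇒≤ n<d)

∑-vanishes : ∀ {n} m (g : Fin m → ℕ → ℕ) → (∀ c → VanishesAbove n (g c)) →
  VanishesAbove n (λ d → ∑[ c < m ] g c d)
∑-vanishes m g v d n<d = trans (sum-cong-≗ (λ c → v c d n<d)) (sum-replicate-zero m)

headDes-vanishes : ∀ n a → VanishesAbove n (headDes n a)
headDes-vanishes zero    a (suc d) _ = refl
headDes-vanishes (suc n) a           =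
  ∑-vanishes (suc n) _ (λ c → step-vanishes (toℕ c <ᵇ a) (headDes-vanishes n (toℕ c)))

totalDes-vanishes : ∀ n → VanishesAbove n (totalDes n)
totalDes-vanishes n = ∑-vanishes (suc n) _ (λ a → headDes-vanishes n (toℕ a))

-- Inserting a new maximum into a permutation of n + 1 letters with d descents,
-- in any of the n + 1 slots after a letter: the d descent slots and the final
-- slot keep the descent count, the remaining n - d slots add one descent.
ins : ℕ → (ℕ → ℕ) → ℕ → ℕ
ins n f d = suc d * f d + (suc n ∸ d) * shift f d

ins-∑ : ∀ n m (g : Fin m → ℕ → ℕ) d → ins n (λ e → ∑[ c < m ] g c e) d ≡ ∑[ c < m ] ins n (g c) d
ins-∑ n m g d = begin
  suc d * ∑[ c < m ] g c d + (suc n ∸ d) * shift (λ e → ∑[ c < m ] g c e) d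
    ≡⟨ cong₂ _+_ (*-distribˡ-sum (suc d) (λ c → g c d))
                 (trans (cong ((suc n ∸ d) *_) (shift-∑ m g d)) (*-distribˡ-sum (suc n ∸ d) (λ c → shift (g c) d))) ⟩
  ∑[ c < m ] (suc d * g c d) + ∑[ c < m ] ((suc n ∸ d) * shift (g c) d)
    ≡⟨ ∑-distrib-+ (λ c → suc d * g c d) (λ c → (suc n ∸ d) * shift (g c) d) ⟨
  ∑[ c < m ] ins n (g c) d ∎

-- One more letter gives one more ascent slot: ins (n + 1) f exceeds ins n f by
-- shift f, provided f counts nothing with more than n descents.
ins-absorb : ∀ {n f} → VanishesAbove n f → ∀ d → ins n f d + shift f d ≡ ins (suc n) f d
ins-absorb {n} {f} v zero    =
  trans (+-identityʳ _) (cong (1 * f 0 +_) (trans (*-zeroʳ (suc n)) (sym (*-zeroʳ (suc (suc n))))))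
ins-absorb {n} {f} v (suc d) =
  trans (+-assoc (suc (suc d) * f (suc d)) _ (f d)) (cong (suc (suc d) * f (suc d) +_) slot)
  where
  slot : (n ∸ d) * f d + f d ≡ (suc n ∸ d) * f d
  slot with d ≤? n
  ... | yes d≤n = trans (+-comm ((n ∸ d) * f d) (f d)) (cong (_* f d) (sym (+-∸-assoc 1 d≤n)))
  ... | no  d≰n rewrite v d (≰⇒> d≰n) =
    trans (+-identityʳ _) (trans (*-zeroʳ (n ∸ d)) (sym (*-zeroʳ (suc n ∸ d))))

-- The termwise form of the insertion recurrence: relabelling by step commutes
-- with inserting the maximum, up to the permutations that start with it.
step-ins : ∀ {n f} → VanishesAbove n f → ∀ b d → step b (ins n f) d + shift f d ≡ ins (suc n) (step b f) d
step-ins v false d             = ins-absorb v d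
step-ins {n} v true zero       = sym (*-zeroʳ (suc (suc n)))
step-ins {n} {f} v true (suc d) = extra-descent (suc d) (f d) ((suc n ∸ d) * shift f d)
  where
  extra-descent : ∀ k x y → k * x + y + x ≡ suc k * x + y
  extra-descent = solve-∀

step-below : ∀ {c m} (f : ℕ → ℕ) d → c < m → step (c <ᵇ m) f d ≡ shift f d
step-below {c} {m} f d c<m with c <ᵇ m | <⇒<ᵇ c<m
... | true | _ = refl

step-notBelow : ∀ {c m} (f : ℕ → ℕ) d → m ≤ c → step (c <ᵇ m) f d ≡ f d
step-notBelow {c} {m} f d m≤c with c <ᵇ m | <ᵇ⇒< c m
... | false | _    = refl
... | true  | c<m = ⊥-elim (<⇒≱ (c<m _) m≤c)

-- A permutation starting with its maximum n + 1 starts with a descent,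
-- followed by an arbitrary permutation of the other letters.
headDes-top : ∀ n d → headDes (suc n) (suc n) d ≡ shift (totalDes n) d
headDes-top n d = begin
  ∑[ c < suc n ] step (toℕ c <ᵇ suc n) (headDes n (toℕ c)) d
    ≡⟨ ∑-cong< (suc n) _ (λ c → shift (headDes n c) d) (λ c c<n → step-below (headDes n c) d c<n) ⟩
  ∑[ c < suc n ] shift (headDes n (toℕ c)) d
    ≡⟨ shift-∑ (suc n) (λ c → headDes n (toℕ c)) d ⟨
  shift (totalDes n) d ∎

-- Insertion of the maximum, refined by the first letter a (which is not the
-- maximum): headDes (n + 1) a = ins n (headDes n a).
insertMax : ∀ n a → a ≤ n → ∀ d → headDes (suc n) a d ≡ ins n (headDes n a) d
insertMax zero    zero _   zero    = refl
insertMax zero    zero _   (suc d) = sym (cong₂ _+_ (*-zeroʳ (suc (suc d))) (cong (_* headDes 0 0 d) (0∸n≡0 d)))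
insertMax (suc n) a    a≤n d       = begin
  ∑[ c < suc (suc n) ] step (toℕ c <ᵇ a) (H′ (toℕ c)) d
    ≡⟨ ∑-last (suc n) (λ c → step (c <ᵇ a) (H′ c) d) ⟩
  ∑[ c < suc n ] step (toℕ c <ᵇ a) (H′ (toℕ c)) d + step (suc n <ᵇ a) (H′ (suc n)) d
    ≡⟨ cong (∑[ c < suc n ] step (toℕ c <ᵇ a) (H′ (toℕ c)) d +_)
            (trans (step-notBelow (H′ (suc n)) d a≤n) (trans (headDes-top n d) (shift-∑ (suc n) (λ c → H (toℕ c)) d))) ⟩
  ∑[ c < suc n ] step (toℕ c <ᵇ a) (H′ (toℕ c)) d + ∑[ c < suc n ] shift (H (toℕ c)) d
    ≡⟨ ∑-distrib-+ {suc n} (λ c → step (toℕ c <ᵇ a) (H′ (toℕ c)) d) (λ c → shift (H (toℕ c)) d) ⟨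
  ∑[ c < suc n ] (step (toℕ c <ᵇ a) (H′ (toℕ c)) d + shift (H (toℕ c)) d)
    ≡⟨ ∑-cong< (suc n) _ _ (λ c c<n → cong (_+ shift (H c) d) (step-cong (c <ᵇ a) (insertMax n c (≤-pred c<n)) d)) ⟩
  ∑[ c < suc n ] (step (toℕ c <ᵇ a) (ins n (H (toℕ c))) d + shift (H (toℕ c)) d)
    ≡⟨ sum-cong-≗ {suc n} (λ c → step-ins (headDes-vanishes n (toℕ c)) (toℕ c <ᵇ a) d) ⟩
  ∑[ c < suc n ] ins (suc n) (step (toℕ c <ᵇ a) (H (toℕ c))) d
    ≡⟨ ins-∑ (suc n) (suc n) (λ c → step (toℕ c <ᵇ a) (H (toℕ c))) d ⟨
  ins (suc n) (headDes (suc n) a) d ∎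
  where
  H H′ : ℕ → ℕ → ℕ
  H  = headDes n
  H′ = headDes (suc n)

totalDes-rec : ∀ n d → totalDes (suc n) d ≡ ins (suc n) (totalDes n) d
totalDes-rec n d = begin
  ∑[ a < suc (suc n) ] headDes (suc n) (toℕ a) d
    ≡⟨ ∑-last (suc n) (λ a → headDes (suc n) a d) ⟩
  ∑[ a < suc n ] headDes (suc n) (toℕ a) d + headDes (suc n) (suc n) d
    ≡⟨ cong₂ _+_ (∑-cong< (suc n) _ _ (λ a a<n → insertMax n a (≤-pred a<n) d)) (headDes-top n d) ⟩
  ∑[ a < suc n ] ins n (headDes n (toℕ a)) d + shift (totalDes n) d
    ≡⟨ cong (_+ shift (totalDes n) d) (ins-∑ n (suc n) (λ a → headDes n (toℕ a)) d) ⟨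
  ins n (totalDes n) d + shift (totalDes n) d
    ≡⟨ ins-absorb (totalDes-vanishes n) d ⟩
  ins (suc n) (totalDes n) d ∎

-- The Eulerian triangle indexed by descents d and ascents a, so that
-- eulerianTri d a = A(d + a + 1, d + 1); it satisfies
-- A(n, k) = k A(n-1, k) + (n-k+1) A(n-1, k-1).
eulerianTri : ℕ → ℕ → ℕ
eulerianTri zero    a       = 1
eulerianTri (suc d) zero    = 1
eulerianTri (suc d) (suc a) = suc (suc d) * eulerianTri (suc d) a + suc (suc a) * eulerianTri d (suc a)

eulerianTri-noAscent : ∀ d → eulerianTri d zero ≡ 1
eulerianTri-noAscent zero    = refl
eulerianTri-noAscent (suc d) = refl

totalDes-noDescent : ∀ n → totalDes n 0 ≡ 1
totalDes-noDescent zero    = refl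
totalDes-noDescent (suc n) = begin
  totalDes (suc n) 0                    ≡⟨ totalDes-rec n 0 ⟩
  1 * totalDes n 0 + suc (suc n) * 0    ≡⟨ cong₂ _+_ (*-identityˡ (totalDes n 0)) (*-zeroʳ (suc (suc n))) ⟩
  totalDes n 0 + 0                      ≡⟨ +-identityʳ _ ⟩
  totalDes n 0                          ≡⟨ totalDes-noDescent n ⟩
  1 ∎

totalDes-noAscent : ∀ n → totalDes n n ≡ 1
totalDes-noAscent zero    = refl
totalDes-noAscent (suc n) = begin
  totalDes (suc n) (suc n)                                      ≡⟨ totalDes-rec n (suc n) ⟩
  suc (suc n) * totalDes n (suc n) + (suc n ∸ n) * totalDes n n
    ≡⟨ cong₂ _+_ (cong (suc (suc n) *_) (totalDes-vanishes n (suc n) (n<1+n n)))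
                 (cong₂ _*_ (m+n∸n≡m 1 n) (totalDes-noAscent n)) ⟩
  suc (suc n) * 0 + 1                                           ≡⟨ cong (_+ 1) (*-zeroʳ (suc (suc n))) ⟩
  1 ∎

totalDes-eulerianTri : ∀ d a → totalDes (d + a) d ≡ eulerianTri d a
totalDes-eulerianTri zero    a       = totalDes-noDescent a
totalDes-eulerianTri (suc d) zero    =
  trans (cong (λ n → totalDes n (suc d)) (+-identityʳ (suc d))) (totalDes-noAscent (suc d))
totalDes-eulerianTri (suc d) (suc a) = begin
  totalDes (suc (d + suc a)) (suc d)
    ≡⟨ totalDes-rec (d + suc a) (suc d) ⟩
  suc (suc d) * totalDes (d + suc a) (suc d) + (suc (d + suc a) ∸ d) * totalDes (d + suc a) d
    ≡⟨ cong₂ _+_ (cong (suc (suc d) *_) (trans (cong (λ n → totalDes n (suc d)) (+-suc d a))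
                                              (totalDes-eulerianTri (suc d) a)))
                 (cong₂ _*_ ascents (totalDes-eulerianTri d (suc a))) ⟩
  eulerianTri (suc d) (suc a) ∎
  where
  ascents : suc (d + suc a) ∸ d ≡ suc (suc a)
  ascents = trans (cong (_∸ d) (sym (+-suc d (suc a)))) (m+n∸m≡n d (suc (suc a)))

eulerian-eulerianTri : ∀ d a → Eulerian (suc d + a) (suc d) ≡ eulerianTri d a
eulerian-eulerianTri d a = trans (eulerian-totalDes (d + a) d) (totalDes-eulerianTri d a)

-- shift² f i = f (i - 2) for i ≥ 2 and 0 otherwise: lowering an exponent by two.
shift² : (ℕ → ℕ) → ℕ → ℕ
shift² f = shift (shift f)

shift²-+ : ∀ (f g : ℕ → ℕ) i → shift² (λ x → f x + g x) i ≡ shift² f i + shift² g i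
shift²-+ f g zero          = refl
shift²-+ f g (suc zero)    = refl
shift²-+ f g (suc (suc i)) = refl

shift²-zero : ∀ i → shift² (λ _ → 0) i ≡ 0
shift²-zero zero          = refl
shift²-zero (suc zero)    = refl
shift²-zero (suc (suc i)) = refl

term : ℕ → ℕ → ℕ → ℕ → ℕ → ℕ
term c a b i j = if (i ≡ᵇ a) ∧ (j ≡ᵇ b) then c else 0

term-scale : ∀ x y c k l → (T x → T y → k ≡ l) → (if x ∧ y then c * k else 0) ≡ l * (if x ∧ y then c else 0)
term-scale true  true  c k l e rewrite e _ _ = *-comm c l
term-scale true  false c k l e = sym (*-zeroʳ l)
term-scale false y     c k l e = sym (*-zeroʳ l)

-- D (y · c yᵃzᵇ) = c (a+1) yᵃ z^(b+2) + c b y^(a+2) zᵇ, read off coefficientwise;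
-- term-z² handles the first summand, term-y² the second.
term-z² : ∀ c a b i j → term (c * suc a) a (b + 2) i j ≡ suc i * shift² (term c a b i) j
term-z² c a b i zero    rewrite +-comm b 2 =
  trans (cong (λ x → if x then c * suc a else 0) (∧-zeroʳ (i ≡ᵇ a))) (sym (*-zeroʳ (suc i)))
term-z² c a b i (suc zero) rewrite +-comm b 2 =
  trans (cong (λ x → if x then c * suc a else 0) (∧-zeroʳ (i ≡ᵇ a))) (sym (*-zeroʳ (suc i)))
term-z² c a b i (suc (suc j)) rewrite +-comm b 2 =
  term-scale (i ≡ᵇ a) (j ≡ᵇ b) c (suc a) (suc i) (λ i≡a _ → cong suc (sym (≡ᵇ⇒≡ i a i≡a)))

term-y² : ∀ c a b i j → term (c * b) (suc (suc a)) b i j ≡ j * shift² (λ i′ → term c a b i′ j) i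
term-y² c a b zero          j = sym (*-zeroʳ j)
term-y² c a b (suc zero)    j = sym (*-zeroʳ j)
term-y² c a b (suc (suc i)) j = term-scale (i ≡ᵇ a) (j ≡ᵇ b) c b j (λ _ j≡b → sym (≡ᵇ⇒≡ j b j≡b))

coeff-D-mulY : ∀ p i j →
  coeff (D (mulY p)) i j ≡ suc i * shift² (coeff p i) j + j * shift² (λ i′ → coeff p i′ j) i
coeff-D-mulY []              i j = sym (cong₂ _+_ (trans (cong (suc i *_) (shift²-zero j)) (*-zeroʳ (suc i)))
                                                  (trans (cong (j *_) (shift²-zero i)) (*-zeroʳ j)))
coeff-D-mulY ((c , a , b) ∷ p) i j = begin
  term (c * suc a) a (b + 2) i j + (term (c * b) (suc (suc a)) b i j + coeff (D (mulY p)) i j)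
    ≡⟨ cong₂ _+_ (term-z² c a b i j) (cong₂ _+_ (term-y² c a b i j) (coeff-D-mulY p i j)) ⟩
  suc i * Z₁ + (j * Y₁ + (suc i * Z₂ + j * Y₂))
    ≡⟨ regroup (suc i) j Z₁ Z₂ Y₁ Y₂ ⟩
  suc i * (Z₁ + Z₂) + j * (Y₁ + Y₂)
    ≡⟨ cong₂ _+_ (cong (suc i *_) (shift²-+ (term c a b i) (coeff p i) j))
                 (cong (j *_) (shift²-+ (λ i′ → term c a b i′ j) (λ i′ → coeff p i′ j) i)) ⟨
  suc i * shift² (λ j′ → term c a b i j′ + coeff p i j′) j
    + j * shift² (λ i′ → term c a b i′ j + coeff p i′ j) i ∎
  where
  Z₁ = shift² (term c a b i) j
  Z₂ = shift² (coeff p i) j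
  Y₁ = shift² (λ i′ → term c a b i′ j) i
  Y₂ = shift² (λ i′ → coeff p i′ j) i
  regroup : ∀ k l z₁ z₂ y₁ y₂ → k * z₁ + (l * y₁ + (k * z₂ + l * y₂)) ≡ k * (z₁ + z₂) + l * (y₁ + y₂)
  regroup = solve-∀

iterDy : ℕ → Poly
iterDy n = DyPow n polyY

coeff-noZ : ∀ n i → coeff (iterDy (suc n)) i 0 ≡ 0
coeff-noZ n i = trans (coeff-D-mulY (iterDy n) i 0) (trans (+-identityʳ _) (*-zeroʳ (suc i)))

shift²-odd : ∀ (f : ℕ → ℕ) a → shift² f (suc (2 * suc a)) ≡ f (suc (2 * a))
shift²-odd f a = cong (λ i → shift² f (suc i)) (*-suc 2 a)

coeff-iterDy : ∀ d a → coeff (iterDy (suc (d + a))) (suc (2 * a)) (2 + 2 * d) ≡ 2 ^ suc (d + a) * eulerianTri d a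
coeff-iterDy zero    zero    = refl
coeff-iterDy zero    (suc a) = begin
  coeff (D (mulY p)) (suc (2 * suc a)) 2
    ≡⟨ coeff-D-mulY p (suc (2 * suc a)) 2 ⟩
  suc (suc (2 * suc a)) * coeff p (suc (2 * suc a)) 0 + 2 * shift² (λ i → coeff p i 2) (suc (2 * suc a))
    ≡⟨ cong₂ _+_ (trans (cong (suc (suc (2 * suc a)) *_) (coeff-noZ a (suc (2 * suc a)))) (*-zeroʳ (suc (suc (2 * suc a)))))
                 (cong (2 *_) (trans (shift²-odd (λ i → coeff p i 2) a) (coeff-iterDy zero a))) ⟩
  2 * (2 ^ suc a * 1)
    ≡⟨ *-assoc 2 (2 ^ suc a) 1 ⟨
  2 ^ suc (suc a) * 1 ∎
  where
  p = iterDy (suc a)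
coeff-iterDy (suc d) zero    = begin
  coeff (D (mulY p)) 1 (2 + 2 * suc d)
    ≡⟨ coeff-D-mulY p 1 (2 + 2 * suc d) ⟩
  2 * coeff p 1 (2 * suc d) + (2 + 2 * suc d) * 0
    ≡⟨ cong₂ _+_ (cong (2 *_) (trans (cong (coeff p 1) (*-suc 2 d)) (trans (coeff-iterDy d zero)
                                               (cong (2 ^ suc (d + 0) *_) (eulerianTri-noAscent d))))) (*-zeroʳ (2 + 2 * suc d)) ⟩
  2 * (2 ^ suc (d + 0) * 1) + 0
    ≡⟨ trans (+-identityʳ _) (sym (*-assoc 2 (2 ^ suc (d + 0)) 1)) ⟩
  2 ^ suc (suc d + 0) * 1 ∎
  where
  p = iterDy (suc (d + 0))
coeff-iterDy (suc d) (suc a) = begin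
  coeff (D (mulY p)) (suc (2 * suc a)) (2 + 2 * suc d)
    ≡⟨ coeff-D-mulY p (suc (2 * suc a)) (2 + 2 * suc d) ⟩
  suc (suc (2 * suc a)) * coeff p (suc (2 * suc a)) (2 * suc d)
    + (2 + 2 * suc d) * shift² (λ i → coeff p i (2 + 2 * suc d)) (suc (2 * suc a))
    ≡⟨ cong₂ _+_ (cong (suc (suc (2 * suc a)) *_) (trans (cong (coeff p (suc (2 * suc a))) (*-suc 2 d)) (coeff-iterDy d (suc a))))
                 (cong ((2 + 2 * suc d) *_) (trans (shift²-odd (λ i → coeff p i (2 + 2 * suc d)) a) fewerAscents)) ⟩
  suc (suc (2 * suc a)) * (2 ^ suc (d + suc a) * eulerianTri d (suc a))
    + (2 + 2 * suc d) * (2 ^ suc (d + suc a) * eulerianTri (suc d) a)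
    ≡⟨ recurrence a d (2 ^ suc (d + suc a)) (eulerianTri d (suc a)) (eulerianTri (suc d) a) ⟩
  2 ^ suc (suc d + suc a) * eulerianTri (suc d) (suc a) ∎
  where
  p = iterDy (suc (d + suc a))
  fewerAscents : coeff p (suc (2 * a)) (2 + 2 * suc d) ≡ 2 ^ suc (d + suc a) * eulerianTri (suc d) a
  fewerAscents = subst (λ n → coeff (iterDy (suc n)) (suc (2 * a)) (2 + 2 * suc d) ≡ 2 ^ suc n * eulerianTri (suc d) a)
                       (sym (+-suc d a)) (coeff-iterDy (suc d) a)
  recurrence : ∀ a d P x y → suc (suc (2 * suc a)) * (P * x) + (2 + 2 * suc d) * (P * y)
                           ≡ 2 * P * (suc (suc d) * y + suc (suc a) * x)
  recurrence = solve-∀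

E-coeff : ∀ d a → E (suc d + a) (suc d) ≡ coeff (iterDy (suc (d + a))) (suc (2 * a)) (2 + 2 * d)
E-coeff d a = cong₂ (coeff (iterDy (suc (d + a)))) yExponent (*-suc 2 d)
  where
  yExponent : 2 * (suc d + a) ∸ 2 * suc d + 1 ≡ suc (2 * a)
  yExponent = begin
    2 * (suc d + a) ∸ 2 * suc d + 1   ≡⟨ cong (λ x → x ∸ 2 * suc d + 1) (*-distribˡ-+ 2 (suc d) a) ⟩
    2 * suc d + 2 * a ∸ 2 * suc d + 1 ≡⟨ cong (_+ 1) (m+n∸m≡n (2 * suc d) (2 * a)) ⟩
    2 * a + 1                         ≡⟨ +-comm (2 * a) 1 ⟩
    suc (2 * a) ∎

mainTheorem3 : (n k : ℕ) → 1 ≤ k → k ≤ n → E n k ≡ 2 ^ n * Eulerian n k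
mainTheorem3 n (suc d) _ k≤n with m≤n⇒∃[o]m+o≡n k≤n
... | a , refl = begin
  E (suc d + a) (suc d)                               ≡⟨ E-coeff d a ⟩
  coeff (iterDy (suc (d + a))) (suc (2 * a)) (2 + 2 * d) ≡⟨ coeff-iterDy d a ⟩
  2 ^ (suc d + a) * eulerianTri d a                   ≡⟨ cong (2 ^ (suc d + a) *_) (eulerian-eulerianTri d a) ⟨
  2 ^ (suc d + a) * Eulerian (suc d + a) (suc d)      ∎
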